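{- Let $\Phi=(\Phi_1|\cdots|\Phi_k)$ be a set composition of $[n]$. Then $$\mathbf{F}_\Phi=\sum_{\Psi\text{ reforms }\Phi}\mathbf{M}_\Psi,$$ and hence $\{\mathbf{F}_\Phi\}$ (over all set compositions $\Phi$) is a basis of $\mathrm{NCQSym}(\mathbf{x})$.
   Context: A set composition of $[n]$ is a sequence $(\Phi_1|\cdots|\Phi_k)$ of disjoint nonempty subsets with union $[n]$. $\mathbf{M}_\Phi=\sum\mathbf{x}_{i_1}\cdots\mathbf{x}_{i_n}$ (noncommuting variables) over all tuples with $i_j=i_l$ whenever $j,l$ lie in the same block and $i_j<i_l$ whenever $j\in\Phi_p$, $l\in\Phi_q$, $p<q$. $\mathrm{NCQSym}(\mathbf{x})$ is the space of bounded-degree power series in noncommuting variables such that, for every set composition $\Phi$ of $[n]$, all monomials $\mathbf{x}_{i_1}\cdots\mathbf{x}_{i_n}$ satisfying the two conditions just stated for $\Phi$ have the same coefficient; equivalently the span of the $\mathbf{M}_\Phi$. Writing the elements of each block in increasing order, $\Psi$ reforms $\Phi$ if $\Psi$ is obtained from $\Phi$ by inserting bars, i.e. by cutting each block $\Phi_p$ (listed increasingly) into consecutive segments, keeping the order. $\mathbf{F}_\Phi=\mathscr{Y}_{(G,L)}(\mathbf{x})$ where $G$ has vertex set $[n]$ with $L$ the identity, a double edge $c_s\Rightarrow c_{s+1}$ for consecutive elements $c_1<\cdots<c_m$ of each block, and a solid edge $a\rightarrow b$ for every $a\in\Phi_p$, $b\in\Phi_q$ with $p<q$; here $\mathscr{Y}_{(G,L)}(\mathbf{x})=\sum_\kappa\mathbf{x}_{\kappa(1)}\cdots\mathbf{x}_{\kappa(n)}$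 over maps $\kappa:[n]\to\mathbb{P}$ with $\kappa(a)<\kappa(b)$ for solid edges $a\rightarrow b$ and $\kappa(a)\le\kappa(b)$ for double edges $a\Rightarrow b$. -}

module Defs where

open import Data.Nat as ℕ using (ℕ; zero; suc)
import Data.Nat.Properties as ℕP
open import Data.Fin as Fin using (Fin; toℕ)
import Data.Fin.Properties as FinP
open import Data.Vec using (Vec; lookup)
open import Data.Product using (Σ; ∃; _×_; _,_; proj₁; proj₂)
open import Data.List using (List; []; _∷_; map)
open import Data.Rational using (ℚ; 0ℚ; 1ℚ; _+_; _*_)
open import Relation.Binary.PropositionalEquality using (_≡_; refl)
open import Relation.Nullary using (¬_; Dec; yes; no)
open import Relation.Nullary.Decidable using (_×-dec_; _→-dec_; ¬?)

-- A monomial x_{i₁}⋯x_{iₘ} of degree m is a word w : Vec ℕ m,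
-- where the letter j stands for the variable x_{j+1}.

Series : Set
Series = (m : ℕ) → Vec ℕ m → ℚ

_⊕_ : Series → Series → Series
(f ⊕ g) m w = f m w + g m w

zeroS : Series
zeroS m w = 0ℚ

_·_ : ℚ → Series → Series
(c · f) m w = c * f m w

sumS : List Series → Series
sumS []       = zeroS
sumS (f ∷ fs) = f ⊕ sumS fs

extend : {n : ℕ} → (Vec ℕ n → ℚ) → Series
extend {n} g m w with m ℕ.≟ n
... | yes refl = g w
... | no _     = 0ℚ

ind : {P : Set} → Dec P → ℚ
ind (yes _) = 1ℚ
ind (no _)  = 0ℚ

-- Set compositions of [n] = Fin n.
-- blk i is the index p of the block Φ_p containing i; the blocks are
-- Φ_p = blk⁻¹(p), which are automatically disjoint with union [n];
-- surjectivity says every block is nonempty.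

record SetComp (n : ℕ) : Set where
  constructor setComp
  field
    k    : ℕ
    blk  : Vec (Fin k) n
    .surj : (p : Fin k) → ∃ λ (i : Fin n) → lookup blk i ≡ p

open SetComp public

bl : {n : ℕ} (Φ : SetComp n) → Fin n → Fin (k Φ)
bl Φ i = lookup (blk Φ) i

MCond : {n : ℕ} → SetComp n → Vec ℕ n → Set
MCond {n} Φ w = (i j : Fin n) →
  (bl Φ i ≡ bl Φ j → lookup w i ≡ lookup w j) ×
  (bl Φ i Fin.< bl Φ j → lookup w i ℕ.< lookup w j)

MCond? : {n : ℕ} (Φ : SetComp n) (w : Vec ℕ n) → Dec (MCond Φ w)
MCond? Φ w = FinP.all? λ i → FinP.all? λ j →
  ((bl Φ i FinP.≟ bl Φ j) →-dec (lookup w i ℕ.≟ lookup w j)) ×-dec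
  ((bl Φ i Fin.<? bl Φ j) →-dec (lookup w i ℕ.<? lookup w j))

M : {n : ℕ} → SetComp n → Series
M Φ = extend (λ w → ind (MCond? Φ w))

-- Labelled graphs (G, L) on vertex set [n] with L the identity labelling:
-- solid edges a → b and double edges a ⇒ b, given as decidable relations.

record LGraph (n : ℕ) : Set₁ where
  field
    Solid   : Fin n → Fin n → Set
    Double  : Fin n → Fin n → Set
    solid?  : (a b : Fin n) → Dec (Solid a b)
    double? : (a b : Fin n) → Dec (Double a b)

-- κ : [n] → ℙ is encoded by the word w (κ(i) = w_i + 1); κ is admissible
-- iff κ(a) < κ(b) on solid edges and κ(a) ≤ κ(b) on double edges.
YCond : {n : ℕ} → LGraph n → Vec ℕ n → Set
YCond {n} G w = (a b : Fin n) →
  (LGraph.Solid G a b → lookup w a ℕ.< lookup w b) ×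
  (LGraph.Double G a b → lookup w a ℕ.≤ lookup w b)

YCond? : {n : ℕ} (G : LGraph n) (w : Vec ℕ n) → Dec (YCond G w)
YCond? G w = FinP.all? λ a → FinP.all? λ b →
  (LGraph.solid? G a b →-dec (lookup w a ℕ.<? lookup w b)) ×-dec
  (LGraph.double? G a b →-dec (lookup w a ℕ.≤? lookup w b))

-- 𝒴_(G,L)(x) = Σ_κ x_{κ(1)}⋯x_{κ(n)}: with L the identity, distinct κ give
-- distinct monomials, so the coefficient of the word w is 1 if the map
-- κ = w is admissible and 0 otherwise.
Y : {n : ℕ} → LGraph n → Series
Y G = extend (λ w → ind (YCond? G w))

DoubleΦ : {n : ℕ} → SetComp n → Fin n → Fin n → Set
DoubleΦ {n} Φ a b = (bl Φ a ≡ bl Φ b) × (a Fin.< b) ×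
  ((c : Fin n) → bl Φ c ≡ bl Φ a → a Fin.< c → ¬ (c Fin.< b))

SolidΦ : {n : ℕ} → SetComp n → Fin n → Fin n → Set
SolidΦ Φ a b = bl Φ a Fin.< bl Φ b

GΦ : {n : ℕ} → SetComp n → LGraph n
GΦ Φ = record
  { Solid   = SolidΦ Φ
  ; Double  = DoubleΦ Φ
  ; solid?  = λ a b → bl Φ a Fin.<? bl Φ b
  ; double? = λ a b → (bl Φ a FinP.≟ bl Φ b) ×-dec ((a Fin.<? b) ×-dec
                FinP.all? λ c → (bl Φ c FinP.≟ bl Φ a) →-dec
                  ((a Fin.<? c) →-dec ¬? (c Fin.<? b)))
  }

F : {n : ℕ} → SetComp n → Series
F Φ = Y (GΦ Φ)

-- Ψ reforms Φ: Ψ is obtained by cutting each block of Φ (listed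
-- increasingly) into consecutive segments, keeping the order.

Reforms : {n : ℕ} → SetComp n → SetComp n → Set
Reforms {n} Ψ Φ = ∃ λ (g : Fin (k Ψ) → Fin (k Φ)) →
  ((r s : Fin (k Ψ)) → r Fin.≤ s → g r Fin.≤ g s) ×
  ((i : Fin n) → bl Φ i ≡ g (bl Ψ i)) ×
  ((a b : Fin n) → bl Φ a ≡ bl Φ b → a Fin.< b → bl Ψ a Fin.≤ bl Ψ b)

BoundedDegree : Series → Set
BoundedDegree f = ∃ λ (d : ℕ) → (m : ℕ) → d ℕ.< m → (w : Vec ℕ m) → f m w ≡ 0ℚ

InNCQSym : Series → Set
InNCQSym f = BoundedDegree f ×
  ((n : ℕ) (Φ : SetComp n) (w w′ : Vec ℕ n) →
     MCond Φ w → MCond Φ w′ → f n w ≡ f n w′)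

AnySetComp : Set
AnySetComp = Σ ℕ SetComp

linCombF : List (AnySetComp × ℚ) → Series
linCombF L = sumS (map (λ { ((n , Φ) , c) → c · F Φ }) L)

module Submission where

-- A word w lies in exactly one class M_Ψ, namely Ψ = setCompOf w, and whether w is a
-- monomial of F_Φ (that is, w respects the graph G_Φ) depends only on that class: it does
-- exactly when setCompOf w reforms Φ.
-- Reforming only adds pairs (a, b) with the block of a before the block of b, and adds at
-- least one unless Ψ = Φ, so the expansion is unitriangular with respect to the number
-- #before of such pairs.  Hence M_Ψ = F_Ψ − Σ_{Ψ′ ≠ Ψ reforms Ψ} M_Ψ′ writes every M_Ψ
-- through the F's by descending induction on #before; and a vanishing combination
-- Σ c_Φ F_Φ, evaluated at the canonical word of Φ, only sees the F_Ψ with Ψ ≼ Φ, so all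
-- coefficients vanish by ascending induction.

open import Defs
open import Data.Empty using (⊥-elim)
open import Data.Fin as Fin using (Fin; toℕ; fromℕ<)
import Data.Fin.Properties as Finₚ
open import Data.List using (List; []; _∷_; map; filter; concatMap; upTo; allFin; deduplicate; _++_)
open import Data.List.Membership.Propositional using (_∈_; lose)
import Data.List.Membership.Propositional.Properties as ∈ₚ
open import Data.List.Relation.Unary.All as All using (All; _∷_)
open import Data.List.Relation.Unary.Any using (here; there)
open import Data.List.Relation.Unary.Unique.Propositional using (Unique; _∷_)
import Data.List.Relation.Unary.Unique.Propositional.Properties as Uniqueₚ
open import Data.Nat as ℕ using (ℕ; zero; suc; z≤n; s≤s; _∸_)
open import Data.Nat.Induction using (<-wellFounded)
import Data.Nat.Properties as ℕₚ
open import Data.Product using (∃; ∃₂; _×_; _,_; proj₁; proj₂)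
open import Data.Rational using (ℚ; 0ℚ; 1ℚ; _+_; _*_; -_)
import Data.Rational.Properties as ℚₚ
open import Data.Sum using (_⊎_; inj₁; inj₂)
open import Data.Vec using (Vec; lookup; tabulate; []; _∷_)
import Data.Vec.Properties as Vecₚ
open import Function using (_∘_; case_of_)
open import Function.Bundles using (_⇔_; mk⇔)
open import Induction.WellFounded using (Acc; acc)
open import Relation.Binary.Definitions using (tri<; tri≈; tri>)
open import Relation.Binary.PropositionalEquality
open import Relation.Nullary using (¬_; ¬?; Dec; yes; no)
open import Relation.Nullary.Decidable using (_×-dec_; _→-dec_; recompute)

∑ : {A : Set} → (A → ℚ) → List A → ℚ
∑ h []       = 0ℚ
∑ h (x ∷ xs) = h x + ∑ h xs

sumS-map : {A : Set} (h : A → Series) (xs : List A) (m : ℕ) (w : Vec ℕ m) →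
           sumS (map h xs) m w ≡ ∑ (λ x → h x m w) xs
sumS-map h []       m w = refl
sumS-map h (x ∷ xs) m w = cong (h x m w +_) (sumS-map h xs m w)

∑-zero : {A : Set} {h : A → ℚ} (xs : List A) →
         (∀ {x} → x ∈ xs → h x ≡ 0ℚ) → ∑ h xs ≡ 0ℚ
∑-zero []       h≡0 = refl
∑-zero (x ∷ xs) h≡0 =
  trans (cong₂ _+_ (h≡0 (here refl)) (∑-zero xs (h≡0 ∘ there))) (ℚₚ.+-identityˡ 0ℚ)

∑-single-key : {A B : Set} (key : A → B) {h : A → ℚ} {xs : List A} → Unique (map key xs) →
               ∀ {x} → x ∈ xs → (∀ {y} → y ∈ xs → key y ≢ key x → h y ≡ 0ℚ) → ∑ h xs ≡ h x
∑-single-key key {h} {y ∷ xs} (y∉ ∷ _) (here refl) h≡0 =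
  trans (cong (h y +_) (∑-zero xs (λ z∈ → h≡0 (there z∈) (λ e → All.lookup y∉ (∈ₚ.∈-map⁺ key z∈) (sym e)))))
        (ℚₚ.+-identityʳ (h y))
∑-single-key key {h} {y ∷ xs} (y∉ ∷ u) {x} (there x∈) h≡0 =
  trans (cong₂ _+_ (h≡0 (here refl) (All.lookup y∉ (∈ₚ.∈-map⁺ key x∈)))
                   (∑-single-key key u x∈ (h≡0 ∘ there)))
        (ℚₚ.+-identityˡ (h x))

∑-single : {A : Set} {h : A → ℚ} {xs : List A} → Unique xs →
           ∀ {x} → x ∈ xs → (∀ {y} → y ∈ xs → y ≢ x → h y ≡ 0ℚ) → ∑ h xs ≡ h x
∑-single u = ∑-single-key (λ x → x) (Uniqueₚ.map⁺ (λ e → e) u)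

∑-++ : {A : Set} (h : A → ℚ) (xs ys : List A) → ∑ h (xs ++ ys) ≡ ∑ h xs + ∑ h ys
∑-++ h []       ys = sym (ℚₚ.+-identityˡ _)
∑-++ h (x ∷ xs) ys = trans (cong (h x +_) (∑-++ h xs ys)) (sym (ℚₚ.+-assoc (h x) _ _))

∑-extract : {A : Set} (_≟_ : (a b : A) → Dec (a ≡ b)) (h : A → ℚ) {xs : List A} → Unique xs →
            ∀ {x} → x ∈ xs → ∑ h xs ≡ h x + ∑ h (filter (λ y → ¬? (y ≟ x)) xs)
∑-extract _≟_ h {y ∷ xs} (y∉ ∷ _) (here refl) with y ≟ y
... | no y≢y = ⊥-elim (y≢y refl)
... | yes _  = cong (h y +_) (cong (∑ h) (sym (filter-all xs y∉)))
  where
  filter-all : (zs : List _) → All (y ≢_) zs → filter (λ z → ¬? (z ≟ y)) zs ≡ zs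
  filter-all []       _ = refl
  filter-all (z ∷ zs) (y≢z ∷ y∉zs) with z ≟ y
  ... | yes z≡y = ⊥-elim (y≢z (sym z≡y))
  ... | no _    = cong (z ∷_) (filter-all zs y∉zs)
∑-extract _≟_ h {y ∷ xs} (y∉ ∷ u) {x} (there x∈) with y ≟ x
... | yes refl = ⊥-elim (All.lookup y∉ x∈ refl)
... | no _     = begin
  h y + ∑ h xs                      ≡⟨ cong (h y +_) (∑-extract _≟_ h u x∈) ⟩
  h y + (h x + rest)                ≡⟨ sym (ℚₚ.+-assoc (h y) (h x) rest) ⟩
  (h y + h x) + rest                ≡⟨ cong (_+ rest) (ℚₚ.+-comm (h y) (h x)) ⟩
  (h x + h y) + rest                ≡⟨ ℚₚ.+-assoc (h x) (h y) rest ⟩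
  h x + (h y + rest)                ∎
  where
  open ≡-Reasoning
  rest = ∑ h (filter (λ z → ¬? (z ≟ x)) xs)

∑ᶠ : (n : ℕ) → (Fin n → ℕ) → ℕ
∑ᶠ zero    f = 0
∑ᶠ (suc n) f = f Fin.zero ℕ.+ ∑ᶠ n (f ∘ Fin.suc)

∑ᶠ-mono-≤ : ∀ n {f g : Fin n → ℕ} → (∀ i → f i ℕ.≤ g i) → ∑ᶠ n f ℕ.≤ ∑ᶠ n g
∑ᶠ-mono-≤ zero    f≤g = z≤n
∑ᶠ-mono-≤ (suc n) f≤g = ℕₚ.+-mono-≤ (f≤g Fin.zero) (∑ᶠ-mono-≤ n (f≤g ∘ Fin.suc))

∑ᶠ-mono-< : ∀ n {f g : Fin n → ℕ} → (∀ i → f i ℕ.≤ g i) → ∀ i → f i ℕ.< g i → ∑ᶠ n f ℕ.< ∑ᶠ n g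
∑ᶠ-mono-< (suc n) f≤g Fin.zero    f<g = ℕₚ.+-mono-<-≤ f<g (∑ᶠ-mono-≤ n (f≤g ∘ Fin.suc))
∑ᶠ-mono-< (suc n) f≤g (Fin.suc i) f<g = ℕₚ.+-mono-≤-< (f≤g Fin.zero) (∑ᶠ-mono-< n (f≤g ∘ Fin.suc) i f<g)

∑ᶠ-≤-* : ∀ n {f : Fin n → ℕ} c → (∀ i → f i ℕ.≤ c) → ∑ᶠ n f ℕ.≤ n ℕ.* c
∑ᶠ-≤-* zero    c f≤c = z≤n
∑ᶠ-≤-* (suc n) c f≤c = ℕₚ.+-mono-≤ (f≤c Fin.zero) (∑ᶠ-≤-* n c (f≤c ∘ Fin.suc))

f≤∑ᶠ : ∀ n (f : Fin n → ℕ) i → f i ℕ.≤ ∑ᶠ n f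
f≤∑ᶠ (suc n) f Fin.zero    = ℕₚ.m≤m+n _ _
f≤∑ᶠ (suc n) f (Fin.suc i) = ℕₚ.≤-trans (f≤∑ᶠ n (f ∘ Fin.suc) i) (ℕₚ.m≤n+m _ _)

χ : {P : Set} → Dec P → ℕ
χ (yes _) = 1
χ (no _)  = 0

χ≤1 : {P : Set} (d : Dec P) → χ d ℕ.≤ 1
χ≤1 (yes _) = s≤s z≤n
χ≤1 (no _)  = z≤n

χ-mono-≤ : {P Q : Set} (d : Dec P) (e : Dec Q) → (P → Q) → χ d ℕ.≤ χ e
χ-mono-≤ (yes p) (yes _) _   = ℕₚ.≤-refl
χ-mono-≤ (yes p) (no ¬q) p⇒q = ⊥-elim (¬q (p⇒q p))
χ-mono-≤ (no _)  _       _   = z≤n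

χ-mono-< : {P Q : Set} (d : Dec P) (e : Dec Q) → ¬ P → Q → χ d ℕ.< χ e
χ-mono-< (yes p) _       ¬p _ = ⊥-elim (¬p p)
χ-mono-< (no _)  (yes _) _  _ = s≤s z≤n
χ-mono-< (no _)  (no ¬q) _  q = ⊥-elim (¬q q)

infix 4 _≐_

_≐_ : Series → Series → Set
f ≐ g = (m : ℕ) (w : Vec ℕ m) → f m w ≡ g m w

extend-≡ : {n : ℕ} (g : Vec ℕ n → ℚ) (w : Vec ℕ n) → extend g n w ≡ g w
extend-≡ {n} g w with n ℕ.≟ n
... | yes refl = refl
... | no n≢n   = ⊥-elim (n≢n refl)

extend-≢ : {n m : ℕ} (g : Vec ℕ n → ℚ) (w : Vec ℕ m) → m ≢ n → extend g m w ≡ 0ℚ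
extend-≢ {n} {m} g w m≢n with m ℕ.≟ n
... | yes refl = ⊥-elim (m≢n refl)
... | no _     = refl

ind-yes : {P : Set} (d : Dec P) → P → ind d ≡ 1ℚ
ind-yes (yes _) _ = refl
ind-yes (no ¬p) p = ⊥-elim (¬p p)

ind-no : {P : Set} (d : Dec P) → ¬ P → ind d ≡ 0ℚ
ind-no (yes p) ¬p = ⊥-elim (¬p p)
ind-no (no _)  _  = refl

ind-cong : {P Q : Set} (d : Dec P) (e : Dec Q) → (P → Q) → (Q → P) → ind d ≡ ind e
ind-cong (yes p) e p⇒q _   = sym (ind-yes e (p⇒q p))
ind-cong (no ¬p) e _   q⇒p = sym (ind-no e (¬p ∘ q⇒p))

M-yes : {n : ℕ} {Ψ : SetComp n} {w : Vec ℕ n} → MCond Ψ w → M Ψ n w ≡ 1ℚ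
M-yes {Ψ = Ψ} {w} c = trans (extend-≡ _ w) (ind-yes (MCond? Ψ w) c)

M-no : {n : ℕ} {Ψ : SetComp n} {w : Vec ℕ n} → ¬ MCond Ψ w → M Ψ n w ≡ 0ℚ
M-no {Ψ = Ψ} {w} ¬c = trans (extend-≡ _ w) (ind-no (MCond? Ψ w) ¬c)

M-≢ : {n m : ℕ} (Ψ : SetComp n) (w : Vec ℕ m) → m ≢ n → M Ψ m w ≡ 0ℚ
M-≢ Ψ = extend-≢ (λ v → ind (MCond? Ψ v))

Y-yes : {n : ℕ} {G : LGraph n} {w : Vec ℕ n} → YCond G w → Y G n w ≡ 1ℚ
Y-yes {G = G} {w} c = trans (extend-≡ _ w) (ind-yes (YCond? G w) c)

Y-no : {n : ℕ} {G : LGraph n} {w : Vec ℕ n} → ¬ YCond G w → Y G n w ≡ 0ℚ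
Y-no {G = G} {w} ¬c = trans (extend-≡ _ w) (ind-no (YCond? G w) ¬c)

-- Set compositions ordered by their strict pairs

surjective : {n : ℕ} (Ψ : SetComp n) (p : Fin (k Ψ)) → ∃ λ i → bl Ψ i ≡ p
surjective (setComp _ v s) p = recompute (Finₚ.any? (λ i → lookup v i Finₚ.≟ p)) (s p)

elementOfBlock : {n : ℕ} (Ψ : SetComp n) {q : ℕ} → q ℕ.< k Ψ → ∃ λ i → toℕ (bl Ψ i) ≡ q
elementOfBlock Ψ q<k with surjective Ψ (fromℕ< q<k)
... | i , e = i , trans (cong toℕ e) (Finₚ.toℕ-fromℕ< q<k)

k≤n : {n : ℕ} (Ψ : SetComp n) → k Ψ ℕ.≤ n
k≤n Ψ = Finₚ.injective⇒≤ {f = proj₁ ∘ surjective Ψ}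
  (λ {p} {q} e → trans (sym (proj₂ (surjective Ψ p))) (trans (cong (bl Ψ) e) (proj₂ (surjective Ψ q))))

setComp-ext : {n : ℕ} {Ψ Φ : SetComp n} → k Ψ ≡ k Φ → (∀ i → toℕ (bl Ψ i) ≡ toℕ (bl Φ i)) → Ψ ≡ Φ
setComp-ext {Ψ = setComp _ u _} {setComp _ v _} refl bl≡ with
  trans (sym (Vecₚ.tabulate∘lookup u))
        (trans (Vecₚ.tabulate-cong (Finₚ.toℕ-injective ∘ bl≡)) (Vecₚ.tabulate∘lookup v))
... | refl = refl

_≟ₛ_ : {n : ℕ} (Ψ Φ : SetComp n) → Dec (Ψ ≡ Φ)
setComp k₁ u _ ≟ₛ setComp k₂ v _ with k₁ ℕ.≟ k₂
... | no k₁≢k₂ = no λ { refl → k₁≢k₂ refl }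
... | yes refl with Vecₚ.≡-dec Finₚ._≟_ u v
...   | yes refl = yes refl
...   | no u≢v   = no λ { refl → u≢v refl }

Before : {n : ℕ} → SetComp n → Fin n → Fin n → Set
Before Ψ a b = bl Ψ a Fin.< bl Ψ b

before? : {n : ℕ} (Ψ : SetComp n) (a b : Fin n) → Dec (Before Ψ a b)
before? Ψ a b = bl Ψ a Fin.<? bl Ψ b

_≼_ : {n : ℕ} → SetComp n → SetComp n → Set
_≼_ {n} Φ Ψ = (a b : Fin n) → Before Φ a b → Before Ψ a b

≼⇒bl≤ : {n : ℕ} {Φ Ψ : SetComp n} → Φ ≼ Ψ → ∀ i → toℕ (bl Φ i) ℕ.≤ toℕ (bl Ψ i)
≼⇒bl≤ {Φ = Φ} {Ψ} Φ≼Ψ i = go _ i refl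
  where
  go : ∀ t i → toℕ (bl Φ i) ≡ t → toℕ (bl Φ i) ℕ.≤ toℕ (bl Ψ i)
  go zero    i e = subst (ℕ._≤ _) (sym e) z≤n
  go (suc q) i e with elementOfBlock Φ (ℕₚ.<-trans (ℕₚ.n<1+n q) (subst (ℕ._< k Φ) e (Finₚ.toℕ<n (bl Φ i))))
  ... | j , jq = begin
    toℕ (bl Φ i)       ≡⟨ e ⟩
    suc q              ≡⟨ cong suc (sym jq) ⟩
    suc (toℕ (bl Φ j)) ≤⟨ s≤s (go q j jq) ⟩
    suc (toℕ (bl Ψ j)) ≤⟨ Φ≼Ψ j i (subst₂ ℕ._<_ (sym jq) (sym e) (ℕₚ.n<1+n q)) ⟩
    toℕ (bl Ψ i)       ∎
    where open ℕₚ.≤-Reasoning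

≼⇒k≤ : {n : ℕ} {Φ Ψ : SetComp n} → Φ ≼ Ψ → k Φ ℕ.≤ k Ψ
≼⇒k≤ {Φ = setComp zero _ _} _ = z≤n
≼⇒k≤ {Φ = Φ@(setComp (suc q) _ _)} {Ψ} Φ≼Ψ with elementOfBlock Φ (ℕₚ.n<1+n q)
... | j , jq = ℕₚ.≤-trans (s≤s (subst (ℕ._≤ toℕ (bl Ψ j)) jq (≼⇒bl≤ {Φ = Φ} {Ψ} Φ≼Ψ j))) (Finₚ.toℕ<n (bl Ψ j))

≼-antisym : {n : ℕ} {Φ Ψ : SetComp n} → Φ ≼ Ψ → Ψ ≼ Φ → Φ ≡ Ψ
≼-antisym {Φ = Φ} {Ψ} Φ≼Ψ Ψ≼Φ = setComp-ext (ℕₚ.≤-antisym (≼⇒k≤ {Φ = Φ} {Ψ} Φ≼Ψ) (≼⇒k≤ {Φ = Ψ} {Φ} Ψ≼Φ))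
  (λ i → ℕₚ.≤-antisym (≼⇒bl≤ {Φ = Φ} {Ψ} Φ≼Ψ i) (≼⇒bl≤ {Φ = Ψ} {Φ} Ψ≼Φ i))

¬≼⇒∃ : {n : ℕ} {Φ Ψ : SetComp n} → ¬ (Φ ≼ Ψ) → ∃₂ λ a b → Before Φ a b × ¬ Before Ψ a b
¬≼⇒∃ {n} {Φ} {Ψ} Φ⋠Ψ
  with Finₚ.¬∀⟶∃¬ n _ (λ a → Finₚ.all? λ b → before? Φ a b →-dec before? Ψ a b) Φ⋠Ψ
... | a , ¬∀b with Finₚ.¬∀⟶∃¬ n _ (λ b → before? Φ a b →-dec before? Ψ a b) ¬∀b
...   | b , ¬imp with before? Φ a b
...     | yes ab = a , b , ab , λ ab′ → ¬imp (λ _ → ab′)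
...     | no ¬ab = ⊥-elim (¬imp (⊥-elim ∘ ¬ab))

#before : {n : ℕ} → SetComp n → ℕ
#before {n} Ψ = ∑ᶠ n λ a → ∑ᶠ n λ b → χ (before? Ψ a b)

#before≤n² : {n : ℕ} (Ψ : SetComp n) → #before Ψ ℕ.≤ n ℕ.* n
#before≤n² {n} Ψ = subst (#before Ψ ℕ.≤_) (cong (n ℕ.*_) (ℕₚ.*-identityʳ n))
  (∑ᶠ-≤-* n (n ℕ.* 1) λ a → ∑ᶠ-≤-* n 1 λ b → χ≤1 (before? Ψ a b))

≼-#before-< : {n : ℕ} {Φ Ψ : SetComp n} → Φ ≼ Ψ → Φ ≢ Ψ → #before Φ ℕ.< #before Ψ
≼-#before-< {n} {Φ} {Ψ} Φ≼Ψ Φ≢Ψ with ¬≼⇒∃ {Φ = Ψ} {Φ} (Φ≢Ψ ∘ ≼-antisym Φ≼Ψ)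
... | a , b , Ψab , ¬Φab =
  ∑ᶠ-mono-< n (λ a′ → ∑ᶠ-mono-≤ n (χ-≤ a′)) a
    (∑ᶠ-mono-< n (χ-≤ a) b (χ-mono-< (before? Φ a b) (before? Ψ a b) ¬Φab Ψab))
  where
  χ-≤ : ∀ a b → χ (before? Φ a b) ℕ.≤ χ (before? Ψ a b)
  χ-≤ a b = χ-mono-≤ (before? Φ a b) (before? Ψ a b) (Φ≼Ψ a b)

wordOf : {n : ℕ} → SetComp n → Vec ℕ n
wordOf Ψ = tabulate (toℕ ∘ bl Ψ)

lookup-wordOf : {n : ℕ} (Ψ : SetComp n) (i : Fin n) → lookup (wordOf Ψ) i ≡ toℕ (bl Ψ i)
lookup-wordOf Ψ = Vecₚ.lookup∘tabulate (toℕ ∘ bl Ψ)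

MCond-wordOf : {n : ℕ} (Ψ : SetComp n) → MCond Ψ (wordOf Ψ)
MCond-wordOf Ψ i j =
  (λ e → trans (lookup-wordOf Ψ i) (trans (cong toℕ e) (sym (lookup-wordOf Ψ j)))) ,
  subst₂ ℕ._<_ (sym (lookup-wordOf Ψ i)) (sym (lookup-wordOf Ψ j))

-- The block of i in setCompOf w is the number of distinct letters of w below w_i.
module Standardisation {n : ℕ} (w : Vec ℕ n) where

  occurs? : (u : ℕ) → Dec (∃ λ i → lookup w i ≡ u)
  occurs? u = Finₚ.any? (λ i → lookup w i ℕ.≟ u)

  rank : ℕ → ℕ
  rank zero    = 0
  rank (suc u) = rank u ℕ.+ χ (occurs? u)

  rank-mono-≤ : ∀ {u v} → u ℕ.≤ v → rank u ℕ.≤ rank v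
  rank-mono-≤ {u} {zero}  z≤n = ℕₚ.≤-refl
  rank-mono-≤ {u} {suc v} u≤v with ℕₚ.m≤n⇒m<n∨m≡n u≤v
  ... | inj₂ refl      = ℕₚ.≤-refl
  ... | inj₁ (s≤s u≤v) = ℕₚ.≤-trans (rank-mono-≤ u≤v) (ℕₚ.m≤m+n (rank v) _)

  rank-occurs : ∀ u → (∃ λ i → lookup w i ≡ u) → rank (suc u) ≡ suc (rank u)
  rank-occurs u occ with occurs? u
  ... | yes _    = ℕₚ.+-comm (rank u) 1
  ... | no ¬occ  = ⊥-elim (¬occ occ)

  rank-mono-< : ∀ i {v} → lookup w i ℕ.< v → rank (lookup w i) ℕ.< rank v
  rank-mono-< i w<v = ℕₚ.≤-trans (ℕₚ.≤-reflexive (sym (rank-occurs _ (i , refl)))) (rank-mono-≤ w<v)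

  #blocks : ℕ
  #blocks = rank (suc (∑ᶠ n (lookup w)))

  rank<#blocks : ∀ i → rank (lookup w i) ℕ.< #blocks
  rank<#blocks i = rank-mono-< i (s≤s (f≤∑ᶠ n (lookup w) i))

  rank-surjective : ∀ v q → q ℕ.< rank v → ∃ λ i → rank (lookup w i) ≡ q
  rank-surjective (suc u) q q<r with occurs? u
  ... | no _ = rank-surjective u q (subst (q ℕ.<_) (ℕₚ.+-identityʳ (rank u)) q<r)
  ... | yes (i , wi≡u) with ℕₚ.m≤n⇒m<n∨m≡n (subst (suc q ℕ.≤_) (ℕₚ.+-comm (rank u) 1) q<r)
  ...   | inj₁ (s≤s q<ru) = rank-surjective u q q<ru
  ...   | inj₂ refl       = i , cong rank wi≡u

  block : Fin n → Fin #blocks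
  block i = fromℕ< (rank<#blocks i)

  setCompOf : SetComp n
  setCompOf = setComp #blocks (tabulate block) onto
    where
    onto : (p : Fin #blocks) → ∃ λ i → lookup (tabulate block) i ≡ p
    onto p with rank-surjective _ (toℕ p) (Finₚ.toℕ<n p)
    ... | i , e = i , trans (Vecₚ.lookup∘tabulate block i)
                            (Finₚ.toℕ-injective (trans (Finₚ.toℕ-fromℕ< (rank<#blocks i)) e))

  toℕ-bl : ∀ i → toℕ (bl setCompOf i) ≡ rank (lookup w i)
  toℕ-bl i = trans (cong toℕ (Vecₚ.lookup∘tabulate block i)) (Finₚ.toℕ-fromℕ< (rank<#blocks i))

  setCompOf-mono : ∀ i j → lookup w i ℕ.≤ lookup w j → bl setCompOf i Fin.≤ bl setCompOf j
  setCompOf-mono i j wi≤wj = subst₂ ℕ._≤_ (sym (toℕ-bl i)) (sym (toℕ-bl j)) (rank-mono-≤ wi≤wj)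

  MCond-setCompOf : MCond setCompOf w
  MCond-setCompOf i j = same , before
    where
    same : bl setCompOf i ≡ bl setCompOf j → lookup w i ≡ lookup w j
    same e with ℕₚ.<-cmp (lookup w i) (lookup w j)
    ... | tri≈ _ wi≡wj _ = wi≡wj
    ... | tri< wi<wj _ _ = ⊥-elim (ℕₚ.<-irrefl (trans (sym (toℕ-bl i)) (trans (cong toℕ e) (toℕ-bl j))) (rank-mono-< i wi<wj))
    ... | tri> _ _ wj<wi = ⊥-elim (ℕₚ.<-irrefl (trans (sym (toℕ-bl j)) (trans (cong toℕ (sym e)) (toℕ-bl i))) (rank-mono-< j wj<wi))
    before : Before setCompOf i j → lookup w i ℕ.< lookup w j
    before bi<bj = ℕₚ.≰⇒> λ wj≤wi → ℕₚ.<⇒≱ bi<bj (setCompOf-mono j i wj≤wi)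

open Standardisation public using (setCompOf; setCompOf-mono; MCond-setCompOf)

MCond⇒≼ : {n : ℕ} {w : Vec ℕ n} (Ψ Φ : SetComp n) → MCond Ψ w → MCond Φ w → Ψ ≼ Φ
MCond⇒≼ Ψ Φ cΨ cΦ a b Ψab with Finₚ.<-cmp (bl Φ a) (bl Φ b)
... | tri< Φab _ _ = Φab
... | tri≈ _ e _   = ⊥-elim (ℕₚ.<-irrefl (proj₁ (cΦ a b) e) (proj₂ (cΨ a b) Ψab))
... | tri> _ _ Φba = ⊥-elim (ℕₚ.<-asym (proj₂ (cΨ a b) Ψab) (proj₂ (cΦ b a) Φba))

MCond-unique : {n : ℕ} {w : Vec ℕ n} (Ψ Φ : SetComp n) → MCond Ψ w → MCond Φ w → Ψ ≡ Φ
MCond-unique {w = w} Ψ Φ cΨ cΦ = ≼-antisym {Φ = Ψ} {Φ} (MCond⇒≼ {w = w} Ψ Φ cΨ cΦ) (MCond⇒≼ {w = w} Φ Ψ cΦ cΨ)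

M-setCompOf : {n : ℕ} (w : Vec ℕ n) → M (setCompOf w) n w ≡ 1ℚ
M-setCompOf w = M-yes {Ψ = setCompOf w} {w} (MCond-setCompOf w)

M-≢setCompOf : {n : ℕ} (Ψ : SetComp n) (w : Vec ℕ n) → Ψ ≢ setCompOf w → M Ψ n w ≡ 0ℚ
M-≢setCompOf Ψ w Ψ≢ = M-no {Ψ = Ψ} {w} λ c → Ψ≢ (MCond-unique {w = w} Ψ (setCompOf w) c (MCond-setCompOf w))

MCond-transfer-< : {n : ℕ} {u v : Vec ℕ n} (Ψ : SetComp n) → MCond Ψ u → MCond Ψ v →
                   ∀ a b → lookup u a ℕ.< lookup u b → lookup v a ℕ.< lookup v b
MCond-transfer-< Ψ cu cv a b ua<ub with Finₚ.<-cmp (bl Ψ a) (bl Ψ b)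
... | tri< Ψab _ _ = proj₂ (cv a b) Ψab
... | tri≈ _ e _   = ⊥-elim (ℕₚ.<-irrefl (proj₁ (cu a b) e) ua<ub)
... | tri> _ _ Ψba = ⊥-elim (ℕₚ.<-asym ua<ub (proj₂ (cu b a) Ψba))

MCond-transfer-≤ : {n : ℕ} {u v : Vec ℕ n} (Ψ : SetComp n) → MCond Ψ u → MCond Ψ v →
                   ∀ a b → lookup u a ℕ.≤ lookup u b → lookup v a ℕ.≤ lookup v b
MCond-transfer-≤ {u = u} {v} Ψ cu cv a b ua≤ub =
  ℕₚ.≮⇒≥ λ vb<va → ℕₚ.<⇒≱ (MCond-transfer-< {u = v} {u} Ψ cv cu b a vb<va) ua≤ub

YCond-transfer : {n : ℕ} (G : LGraph n) {u v : Vec ℕ n} (Ψ : SetComp n) →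
                 MCond Ψ u → MCond Ψ v → YCond G u → YCond G v
YCond-transfer G {u} {v} Ψ cu cv yu a b =
  MCond-transfer-< {u = u} {v} Ψ cu cv a b ∘ proj₁ (yu a b) ,
  MCond-transfer-≤ {u = u} {v} Ψ cu cv a b ∘ proj₂ (yu a b)

allVecs : (k n : ℕ) → List (Vec (Fin k) n)
allVecs k zero    = [] ∷ []
allVecs k (suc n) = concatMap (λ x → map (x ∷_) (allVecs k n)) (allFin k)

∈-allVecs : ∀ {k n} (v : Vec (Fin k) n) → v ∈ allVecs k n
∈-allVecs []      = here refl
∈-allVecs {k} {suc n} (x ∷ v) =
  ∈ₚ.∈-concatMap⁺ (λ x → map (x ∷_) (allVecs k n)) (lose (∈ₚ.∈-allFin x) (∈ₚ.∈-map⁺ (x ∷_) (∈-allVecs v)))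

fromBlockVec : ∀ {n} k (v : Vec (Fin k) n) → List (SetComp n)
fromBlockVec k v with Finₚ.all? (λ p → Finₚ.any? (λ i → lookup v i Finₚ.≟ p))
... | yes onto = setComp k v onto ∷ []
... | no _     = []

∈-fromBlockVec : ∀ {n} (Ψ : SetComp n) → Ψ ∈ fromBlockVec (k Ψ) (blk Ψ)
∈-fromBlockVec Ψ@(setComp k v _) with Finₚ.all? (λ p → Finₚ.any? (λ i → lookup v i Finₚ.≟ p))
... | yes _     = here refl
... | no ¬onto  = ⊥-elim (¬onto (surjective Ψ))

allSetComps : (n : ℕ) → List (SetComp n)
allSetComps n = deduplicate _≟ₛ_ (concatMap (λ k → concatMap (fromBlockVec k) (allVecs k n)) (upTo (suc n)))

allSetComps-unique : ∀ n → Unique (allSetComps n)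
allSetComps-unique n = DecUniqueₚ.deduplicate-! _
  where import Data.List.Relation.Unary.Unique.DecPropositional.Properties (_≟ₛ_ {n}) as DecUniqueₚ

∈-allSetComps : ∀ {n} (Ψ : SetComp n) → Ψ ∈ allSetComps n
∈-allSetComps {n} Ψ = ∈ₚ.∈-deduplicate⁺ _≟ₛ_
  (∈ₚ.∈-concatMap⁺ (λ k → concatMap (fromBlockVec k) (allVecs k n)) (lose (∈ₚ.∈-upTo⁺ (s≤s (k≤n Ψ)))
    (∈ₚ.∈-concatMap⁺ (fromBlockVec (k Ψ)) (lose (∈-allVecs (blk Ψ)) (∈-fromBlockVec Ψ)))))

-- Reforms with the block map g eliminated (g r is the Φ-block of any element of Ψ_r), hence decidable.
Reforms′ : {n : ℕ} → SetComp n → SetComp n → Set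
Reforms′ {n} Ψ Φ =
  ((i j : Fin n) → bl Ψ i ≡ bl Ψ j → bl Φ i ≡ bl Φ j) ×
  ((i j : Fin n) → Before Ψ i j → bl Φ i Fin.≤ bl Φ j) ×
  ((a b : Fin n) → bl Φ a ≡ bl Φ b → a Fin.< b → bl Ψ a Fin.≤ bl Ψ b)

Reforms′? : {n : ℕ} (Ψ Φ : SetComp n) → Dec (Reforms′ Ψ Φ)
Reforms′? Ψ Φ =
  (Finₚ.all? λ i → Finₚ.all? λ j → (bl Ψ i Finₚ.≟ bl Ψ j) →-dec (bl Φ i Finₚ.≟ bl Φ j)) ×-dec
  (Finₚ.all? λ i → Finₚ.all? λ j → before? Ψ i j →-dec (bl Φ i Fin.≤? bl Φ j)) ×-dec
  (Finₚ.all? λ a → Finₚ.all? λ b → (bl Φ a Finₚ.≟ bl Φ b) →-dec ((a Fin.<? b) →-dec (bl Ψ a Fin.≤? bl Ψ b)))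

Reforms⇒Reforms′ : {n : ℕ} (Ψ Φ : SetComp n) → Reforms Ψ Φ → Reforms′ Ψ Φ
Reforms⇒Reforms′ Ψ Φ (g , g-mono , bl≡g , within) =
  (λ i j e → trans (bl≡g i) (trans (cong g e) (sym (bl≡g j)))) ,
  (λ i j Ψij → subst₂ Fin._≤_ (sym (bl≡g i)) (sym (bl≡g j)) (g-mono _ _ (ℕₚ.<⇒≤ Ψij))) ,
  within

Reforms′⇒Reforms : {n : ℕ} (Ψ Φ : SetComp n) → Reforms′ Ψ Φ → Reforms Ψ Φ
Reforms′⇒Reforms Ψ Φ (same , ordered , within) = g , g-mono , bl≡g , within
  where
  pick : Fin (k Ψ) → Fin _
  pick r = proj₁ (surjective Ψ r)
  g : Fin (k Ψ) → Fin (k Φ)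
  g r = bl Φ (pick r)
  g-mono : ∀ r s → r Fin.≤ s → g r Fin.≤ g s
  g-mono r s r≤s with ℕₚ.m≤n⇒m<n∨m≡n r≤s
  ... | inj₂ r≡s = ℕₚ.≤-reflexive (cong (toℕ ∘ g) (Finₚ.toℕ-injective r≡s))
  ... | inj₁ r<s = ordered (pick r) (pick s)
                     (subst₂ Fin._<_ (sym (proj₂ (surjective Ψ r))) (sym (proj₂ (surjective Ψ s))) r<s)
  bl≡g : ∀ i → bl Φ i ≡ g (bl Ψ i)
  bl≡g i = same i (pick (bl Ψ i)) (sym (proj₂ (surjective Ψ (bl Ψ i))))

Reforms′-refl : {n : ℕ} (Ψ : SetComp n) → Reforms′ Ψ Ψ
Reforms′-refl Ψ = (λ _ _ e → e) , (λ _ _ → ℕₚ.<⇒≤) , (λ _ _ e _ → ℕₚ.≤-reflexive (cong toℕ e))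

Reforms′⇒≼ : {n : ℕ} (Ψ Φ : SetComp n) → Reforms′ Ψ Φ → Φ ≼ Ψ
Reforms′⇒≼ Ψ Φ (same , ordered , _) a b Φab with Finₚ.<-cmp (bl Ψ a) (bl Ψ b)
... | tri< Ψab _ _ = Ψab
... | tri≈ _ e _   = ⊥-elim (ℕₚ.<-irrefl (cong toℕ (same a b e)) Φab)
... | tri> _ _ Ψba = ⊥-elim (ℕₚ.<⇒≱ Φab (ordered b a Ψba))

reformsOf : {n : ℕ} → SetComp n → List (SetComp n)
reformsOf {n} Φ = filter (λ Ψ → Reforms′? Ψ Φ) (allSetComps n)

reformsOf-unique : {n : ℕ} (Φ : SetComp n) → Unique (reformsOf Φ)
reformsOf-unique {n} Φ = Uniqueₚ.filter⁺ (λ Ψ → Reforms′? Ψ Φ) (allSetComps-unique n)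

∈-reformsOf⁺ : {n : ℕ} {Ψ Φ : SetComp n} → Reforms′ Ψ Φ → Ψ ∈ reformsOf Φ
∈-reformsOf⁺ {Ψ = Ψ} {Φ} r = ∈ₚ.∈-filter⁺ (λ Ψ → Reforms′? Ψ Φ) (∈-allSetComps Ψ) r

∈-reformsOf⁻ : {n : ℕ} {Ψ Φ : SetComp n} → Ψ ∈ reformsOf Φ → Reforms′ Ψ Φ
∈-reformsOf⁻ {n} {Φ = Φ} Ψ∈ = proj₂ (∈ₚ.∈-filter⁻ (λ Ψ → Reforms′? Ψ Φ) {xs = allSetComps n} Ψ∈)

∈-reformsOf⇔Reforms : {n : ℕ} (Φ Ψ : SetComp n) → (Ψ ∈ reformsOf Φ) ⇔ Reforms Ψ Φ
∈-reformsOf⇔Reforms Φ Ψ = mk⇔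
  (Reforms′⇒Reforms Ψ Φ ∘ ∈-reformsOf⁻ {Ψ = Ψ} {Φ})
  (∈-reformsOf⁺ {Ψ = Ψ} {Φ} ∘ Reforms⇒Reforms′ Ψ Φ)

-- The monomials of F_Φ

NotBetween : {n : ℕ} → SetComp n → Fin n → Fin n → Fin n → Set
NotBetween Φ a b c = bl Φ c ≡ bl Φ a → a Fin.< c → ¬ (c Fin.< b)

notBetween? : {n : ℕ} (Φ : SetComp n) (a b c : Fin n) → Dec (NotBetween Φ a b c)
notBetween? Φ a b c = (bl Φ c Finₚ.≟ bl Φ a) →-dec ((a Fin.<? c) →-dec ¬? (c Fin.<? b))

double-or-between : {n : ℕ} (Φ : SetComp n) {a b : Fin n} → bl Φ a ≡ bl Φ b → a Fin.< b →
                    DoubleΦ Φ a b ⊎ ∃ λ c → bl Φ c ≡ bl Φ a × a Fin.< c × c Fin.< b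
double-or-between {n} Φ {a} {b} e a<b with Finₚ.all? (notBetween? Φ a b)
... | yes none = inj₁ (e , a<b , none)
... | no ¬none with Finₚ.¬∀⟶∃¬ n _ (notBetween? Φ a b) ¬none
...   | c , ¬c with bl Φ c Finₚ.≟ bl Φ a | a Fin.<? c | c Fin.<? b
...     | yes ca | yes a<c | yes c<b = inj₂ (c , ca , a<c , c<b)
...     | no ¬ca | _       | _       = ⊥-elim (¬c (⊥-elim ∘ ¬ca))
...     | _      | no ¬a<c | _       = ⊥-elim (¬c λ _ → ⊥-elim ∘ ¬a<c)
...     | _      | _       | no ¬c<b = ⊥-elim (¬c λ _ _ → ¬c<b)

YCond-G⇒≤ : {n : ℕ} (Φ : SetComp n) {w : Vec ℕ n} → YCond (GΦ Φ) w →
            ∀ a b → bl Φ a ≡ bl Φ b → a Fin.< b → lookup w a ℕ.≤ lookup w b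
YCond-G⇒≤ Φ {w} y a b e a<b = go a b e a<b (<-wellFounded _)
  where
  go : ∀ a b → bl Φ a ≡ bl Φ b → a Fin.< b → Acc ℕ._<_ (toℕ b ∸ toℕ a) → lookup w a ℕ.≤ lookup w b
  go a b e a<b (acc rec) with double-or-between Φ e a<b
  ... | inj₁ a⇒b = proj₂ (y a b) a⇒b
  ... | inj₂ (c , ca , a<c , c<b) = ℕₚ.≤-trans
    (go a c (sym ca) a<c (rec (ℕₚ.∸-monoˡ-< c<b (ℕₚ.<⇒≤ a<c))))
    (go c b (trans ca e) c<b (rec (ℕₚ.∸-monoʳ-< a<c (ℕₚ.<⇒≤ c<b))))

YCond-G⇒Reforms′ : {n : ℕ} (Φ : SetComp n) (w : Vec ℕ n) → YCond (GΦ Φ) w → Reforms′ (setCompOf w) Φ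
YCond-G⇒Reforms′ Φ w y = same , ordered , within
  where
  Ψ = setCompOf w
  same : ∀ i j → bl Ψ i ≡ bl Ψ j → bl Φ i ≡ bl Φ j
  same i j e with Finₚ.<-cmp (bl Φ i) (bl Φ j)
  ... | tri≈ _ Φi≡Φj _ = Φi≡Φj
  ... | tri< Φij _ _   = ⊥-elim (ℕₚ.<-irrefl (proj₁ (MCond-setCompOf w i j) e) (proj₁ (y i j) Φij))
  ... | tri> _ _ Φji   = ⊥-elim (ℕₚ.<-irrefl (sym (proj₁ (MCond-setCompOf w i j) e)) (proj₁ (y j i) Φji))
  ordered : ∀ i j → Before Ψ i j → bl Φ i Fin.≤ bl Φ j
  ordered i j Ψij = ℕₚ.≮⇒≥ λ Φji → ℕₚ.<-asym (proj₂ (MCond-setCompOf w i j) Ψij) (proj₁ (y j i) Φji)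
  within : ∀ a b → bl Φ a ≡ bl Φ b → a Fin.< b → bl Ψ a Fin.≤ bl Ψ b
  within a b e a<b = setCompOf-mono w a b (YCond-G⇒≤ Φ {w} y a b e a<b)

Reforms′⇒YCond-G : {n : ℕ} (Ψ Φ : SetComp n) {w : Vec ℕ n} → Reforms′ Ψ Φ → MCond Ψ w → YCond (GΦ Φ) w
Reforms′⇒YCond-G Ψ Φ {w} r@(_ , _ , within) c a b = solid , double
  where
  solid : SolidΦ Φ a b → lookup w a ℕ.< lookup w b
  solid Φab = proj₂ (c a b) (Reforms′⇒≼ Ψ Φ r a b Φab)
  double : DoubleΦ Φ a b → lookup w a ℕ.≤ lookup w b
  double (e , a<b , _) with ℕₚ.m≤n⇒m<n∨m≡n (within a b e a<b)
  ... | inj₁ Ψab = ℕₚ.<⇒≤ (proj₂ (c a b) Ψab)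
  ... | inj₂ Ψa≡Ψb = ℕₚ.≤-reflexive (proj₁ (c a b) (Finₚ.toℕ-injective Ψa≡Ψb))

F-coeff : {n : ℕ} (Φ : SetComp n) (w : Vec ℕ n) → F Φ n w ≡ ∑ (λ Ψ → M Ψ n w) (reformsOf Φ)
F-coeff {n} Φ w = case YCond? (GΦ Φ) w of λ where
  (yes y) → trans (Y-yes {G = GΦ Φ} {w} y) (sym (trans
    (∑-single (reformsOf-unique Φ) (∈-reformsOf⁺ {Ψ = setCompOf w} {Φ} (YCond-G⇒Reforms′ Φ w y))
              (λ {Ψ} _ → M-≢setCompOf Ψ w))
    (M-setCompOf w)))
  (no ¬y) → trans (Y-no {G = GΦ Φ} {w} ¬y) (sym (∑-zero (reformsOf Φ)
    (λ {Ψ} Ψ∈ → M-no {Ψ = Ψ} {w} (¬y ∘ Reforms′⇒YCond-G Ψ Φ {w} (∈-reformsOf⁻ {Ψ = Ψ} {Φ} Ψ∈)))))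

F≐∑M : {n : ℕ} (Φ : SetComp n) → F Φ ≐ sumS (map M (reformsOf Φ))
F≐∑M {n} Φ m w = case m ℕ.≟ n of λ where
  (yes refl) → trans (F-coeff Φ w) (sym (sumS-map M (reformsOf Φ) m w))
  (no m≢n)   → trans (extend-≢ _ w m≢n)
    (sym (trans (sumS-map M (reformsOf Φ) m w) (∑-zero (reformsOf Φ) (λ _ → extend-≢ _ w m≢n))))

DependsOnPattern : Series → Set
DependsOnPattern f = (n : ℕ) (Φ : SetComp n) (w w′ : Vec ℕ n) → MCond Φ w → MCond Φ w′ → f n w ≡ f n w′

F∈NCQSym : {n : ℕ} (Φ : SetComp n) → InNCQSym (F Φ)
F∈NCQSym {n} Φ = (n , λ m n<m w → extend-≢ _ w (ℕₚ.>⇒≢ n<m)) , onClasses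
  where
  onClasses : DependsOnPattern (F Φ)
  onClasses m Ψ w w′ c c′ = case m ℕ.≟ n of λ where
    (no m≢n)   → trans (extend-≢ _ w m≢n) (sym (extend-≢ _ w′ m≢n))
    (yes refl) → trans (extend-≡ _ w) (trans
      (ind-cong (YCond? (GΦ Φ) w) (YCond? (GΦ Φ) w′)
        (YCond-transfer (GΦ Φ) {w} {w′} Ψ c c′) (YCond-transfer (GΦ Φ) {w′} {w} Ψ c′ c))
      (sym (extend-≡ _ w′)))

-- Spanning

InSpan : Series → Set
InSpan f = ∃ λ (L : List (AnySetComp × ℚ)) → f ≐ linCombF L

term : (m : ℕ) → Vec ℕ m → AnySetComp × ℚ → ℚ
term m w ((_ , Φ) , c) = c * F Φ m w

linCombF-∑ : (L : List (AnySetComp × ℚ)) (m : ℕ) (w : Vec ℕ m) → linCombF L m w ≡ ∑ (term m w) L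
linCombF-∑ []      m w = refl
linCombF-∑ (e ∷ L) m w = cong (term m w e +_) (linCombF-∑ L m w)

scale : ℚ → List (AnySetComp × ℚ) → List (AnySetComp × ℚ)
scale c = map λ (Φ , d) → Φ , c * d

∑-term-scale : (c : ℚ) (L : List (AnySetComp × ℚ)) (m : ℕ) (w : Vec ℕ m) →
               ∑ (term m w) (scale c L) ≡ c * ∑ (term m w) L
∑-term-scale c []      m w = sym (ℚₚ.*-zeroʳ c)
∑-term-scale c (e ∷ L) m w = trans
  (cong₂ _+_ (ℚₚ.*-assoc c (proj₂ e) _) (∑-term-scale c L m w))
  (sym (ℚₚ.*-distribˡ-+ c _ _))

InSpan-≐ : {f g : Series} → f ≐ g → InSpan g → InSpan f
InSpan-≐ f≐g (L , g≐L) = L , λ m w → trans (f≐g m w) (g≐L m w)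

InSpan-F : {n : ℕ} (Φ : SetComp n) → InSpan (F Φ)
InSpan-F {n} Φ = ((n , Φ) , 1ℚ) ∷ [] , λ m w → sym (trans (ℚₚ.+-identityʳ _) (ℚₚ.*-identityˡ _))

InSpan-zero : InSpan zeroS
InSpan-zero = [] , λ m w → refl

InSpan-⊕ : {f g : Series} → InSpan f → InSpan g → InSpan (f ⊕ g)
InSpan-⊕ {f} {g} (L , f≐L) (L′ , g≐L′) = L ++ L′ , λ m w → begin
  f m w + g m w                    ≡⟨ cong₂ _+_ (trans (f≐L m w) (linCombF-∑ L m w)) (trans (g≐L′ m w) (linCombF-∑ L′ m w)) ⟩
  ∑ (term m w) L + ∑ (term m w) L′ ≡⟨ sym (∑-++ (term m w) L L′) ⟩
  ∑ (term m w) (L ++ L′)           ≡⟨ sym (linCombF-∑ (L ++ L′) m w) ⟩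
  linCombF (L ++ L′) m w           ∎
  where open ≡-Reasoning

InSpan-· : (c : ℚ) {f : Series} → InSpan f → InSpan (c · f)
InSpan-· c {f} (L , f≐L) = scale c L , λ m w → begin
  c * f m w                ≡⟨ cong (c *_) (trans (f≐L m w) (linCombF-∑ L m w)) ⟩
  c * ∑ (term m w) L       ≡⟨ sym (∑-term-scale c L m w) ⟩
  ∑ (term m w) (scale c L) ≡⟨ sym (linCombF-∑ (scale c L) m w) ⟩
  linCombF (scale c L) m w ∎
  where open ≡-Reasoning

InSpan-sumS : {A : Set} (h : A → Series) (xs : List A) → (∀ {x} → x ∈ xs → InSpan (h x)) →
              InSpan (sumS (map h xs))
InSpan-sumS h []       _    = InSpan-zero
InSpan-sumS h (x ∷ xs) span = InSpan-⊕ (span (here refl)) (InSpan-sumS h xs (span ∘ there))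

properReformsOf : {n : ℕ} → SetComp n → List (SetComp n)
properReformsOf Ψ = filter (λ Ψ′ → ¬? (Ψ′ ≟ₛ Ψ)) (reformsOf Ψ)

x≡x+y-y : (x y : ℚ) → x ≡ (x + y) + (- 1ℚ) * y
x≡x+y-y x y = sym (begin
  (x + y) + (- 1ℚ) * y ≡⟨ ℚₚ.+-assoc x y _ ⟩
  x + (y + (- 1ℚ) * y) ≡⟨ cong (λ z → x + (y + z)) (trans (sym (ℚₚ.neg-distribˡ-* 1ℚ y)) (cong -_ (ℚₚ.*-identityˡ y))) ⟩
  x + (y + - y)        ≡⟨ cong (x +_) (ℚₚ.+-inverseʳ y) ⟩
  x + 0ℚ               ≡⟨ ℚₚ.+-identityʳ x ⟩
  x                    ∎)
  where open ≡-Reasoning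

M≐F-∑M : {n : ℕ} (Ψ : SetComp n) → M Ψ ≐ F Ψ ⊕ ((- 1ℚ) · sumS (map M (properReformsOf Ψ)))
M≐F-∑M Ψ m w = trans (x≡x+y-y (M Ψ m w) (∑ (λ Ψ′ → M Ψ′ m w) (properReformsOf Ψ))) (cong₂ _+_
  (sym (begin
    F Ψ m w                                           ≡⟨ F≐∑M Ψ m w ⟩
    sumS (map M (reformsOf Ψ)) m w                    ≡⟨ sumS-map M (reformsOf Ψ) m w ⟩
    ∑ (λ Ψ′ → M Ψ′ m w) (reformsOf Ψ)                 ≡⟨ ∑-extract _≟ₛ_ (λ Ψ′ → M Ψ′ m w) (reformsOf-unique Ψ)
                                                           (∈-reformsOf⁺ {Ψ = Ψ} {Ψ} (Reforms′-refl Ψ)) ⟩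
    M Ψ m w + ∑ (λ Ψ′ → M Ψ′ m w) (properReformsOf Ψ) ∎))
  (cong ((- 1ℚ) *_) (sym (sumS-map M (properReformsOf Ψ) m w))))
  where open ≡-Reasoning

M-inSpan : {n : ℕ} (Ψ : SetComp n) → InSpan (M Ψ)
M-inSpan {n} Ψ = go Ψ (<-wellFounded _)
  where
  go : (Ψ : SetComp n) → Acc ℕ._<_ (n ℕ.* n ∸ #before Ψ) → InSpan (M Ψ)
  go Ψ (acc rec) = InSpan-≐ (M≐F-∑M Ψ)
    (InSpan-⊕ (InSpan-F Ψ) (InSpan-· (- 1ℚ) (InSpan-sumS M (properReformsOf Ψ) λ {Ψ′} Ψ′∈ →
      go Ψ′ (rec (ℕₚ.∸-monoʳ-< (more-before Ψ′∈) (#before≤n² Ψ′))))))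
    where
    more-before : ∀ {Ψ′} → Ψ′ ∈ properReformsOf Ψ → #before Ψ ℕ.< #before Ψ′
    more-before {Ψ′} Ψ′∈ with ∈ₚ.∈-filter⁻ (λ Ψ′ → ¬? (Ψ′ ≟ₛ Ψ)) {xs = reformsOf Ψ} Ψ′∈
    ... | Ψ′∈reforms , Ψ′≢Ψ = ≼-#before-< {Φ = Ψ} {Ψ′}
      (Reforms′⇒≼ Ψ′ Ψ (∈-reformsOf⁻ {Ψ = Ψ′} {Ψ} Ψ′∈reforms)) (Ψ′≢Ψ ∘ sym)

homogeneousPart : ℕ → Series → Series
homogeneousPart m f = sumS (map (λ Ψ → f m (wordOf Ψ) · M Ψ) (allSetComps m))

homogeneousPart-≢ : (f : Series) {d m : ℕ} (w : Vec ℕ m) → m ≢ d → homogeneousPart d f m w ≡ 0ℚ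
homogeneousPart-≢ f {d} w m≢d = trans (sumS-map _ (allSetComps d) _ w) (∑-zero (allSetComps d)
  λ {Ψ} _ → trans (cong (f d (wordOf Ψ) *_) (M-≢ Ψ w m≢d)) (ℚₚ.*-zeroʳ (f d (wordOf Ψ))))

homogeneousPart-≡ : (f : Series) → DependsOnPattern f → {m : ℕ} (w : Vec ℕ m) → homogeneousPart m f m w ≡ f m w
homogeneousPart-≡ f onClasses {m} w = begin
  homogeneousPart m f m w                            ≡⟨ sumS-map _ (allSetComps m) m w ⟩
  ∑ (λ Ψ → f m (wordOf Ψ) * M Ψ m w) (allSetComps m) ≡⟨ ∑-single (allSetComps-unique m) (∈-allSetComps Ψ) others ⟩
  f m (wordOf Ψ) * M Ψ m w                           ≡⟨ cong (f m (wordOf Ψ) *_) (M-setCompOf w) ⟩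
  f m (wordOf Ψ) * 1ℚ                                ≡⟨ ℚₚ.*-identityʳ _ ⟩
  f m (wordOf Ψ)                                     ≡⟨ onClasses m Ψ (wordOf Ψ) w (MCond-wordOf Ψ) (MCond-setCompOf w) ⟩
  f m w                                              ∎
  where
  open ≡-Reasoning
  Ψ = setCompOf w
  others : ∀ {Ψ′} → Ψ′ ∈ allSetComps m → Ψ′ ≢ Ψ → f m (wordOf Ψ′) * M Ψ′ m w ≡ 0ℚ
  others {Ψ′} _ Ψ′≢Ψ = trans (cong (f m (wordOf Ψ′) *_) (M-≢setCompOf Ψ′ w Ψ′≢Ψ)) (ℚₚ.*-zeroʳ (f m (wordOf Ψ′)))

truncation : Series → ℕ → Series
truncation f d = sumS (map (λ j → homogeneousPart j f) (upTo (suc d)))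

NCQSym≐truncation : (f : Series) → ((d , _) : BoundedDegree f) → DependsOnPattern f → f ≐ truncation f d
NCQSym≐truncation f (d , vanish) onClasses m w =
  trans (coeff (m ℕ.≤? d)) (sym (sumS-map (λ j → homogeneousPart j f) (upTo (suc d)) m w))
  where
  coeff : Dec (m ℕ.≤ d) → f m w ≡ ∑ (λ j → homogeneousPart j f m w) (upTo (suc d))
  coeff (yes m≤d) = sym (trans
    (∑-single (Uniqueₚ.upTo⁺ (suc d)) (∈ₚ.∈-upTo⁺ (s≤s m≤d)) (λ _ j≢m → homogeneousPart-≢ f w (j≢m ∘ sym)))
    (homogeneousPart-≡ f onClasses w))
  coeff (no m≰d) = trans (vanish m (ℕₚ.≰⇒> m≰d) w) (sym (∑-zero (upTo (suc d)) λ j∈ →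
    homogeneousPart-≢ f w (ℕₚ.>⇒≢ (ℕₚ.<-≤-trans (∈ₚ.∈-upTo⁻ j∈) (ℕₚ.≰⇒> m≰d)))))

NCQSym⊆span : (f : Series) → InNCQSym f → InSpan f
NCQSym⊆span f (bounded@(d , _) , onClasses) = InSpan-≐ (NCQSym≐truncation f bounded onClasses)
  (InSpan-sumS _ (upTo (suc d)) λ {j} _ → InSpan-sumS _ (allSetComps j) λ {Ψ} _ →
    InSpan-· (f j (wordOf Ψ)) (M-inSpan Ψ))

-- Linear independence

F-wordOf : {n : ℕ} (Φ : SetComp n) → F Φ n (wordOf Φ) ≡ 1ℚ
F-wordOf Φ = Y-yes {G = GΦ Φ} {wordOf Φ} (Reforms′⇒YCond-G Φ Φ {wordOf Φ} (Reforms′-refl Φ) (MCond-wordOf Φ))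

YCond-G-wordOf⇒≼ : {n : ℕ} (Ψ Φ : SetComp n) → YCond (GΦ Ψ) (wordOf Φ) → Ψ ≼ Φ
YCond-G-wordOf⇒≼ Ψ Φ y a b Ψab = subst₂ ℕ._<_ (lookup-wordOf Φ a) (lookup-wordOf Φ b) (proj₁ (y a b) Ψab)

linCombF-independent : (L : List (AnySetComp × ℚ)) → Unique (map proj₁ L) → linCombF L ≐ zeroS →
                       All (λ p → proj₂ p ≡ 0ℚ) L
linCombF-independent L keys-unique L≐0 = All.tabulate λ {e} e∈ → go e e∈ (<-wellFounded _)
  where
  go : ∀ e → e ∈ L → Acc ℕ._<_ (#before (proj₂ (proj₁ e))) → proj₂ e ≡ 0ℚ
  go ((n , Φ) , c) e∈ (acc rec) = begin
    c                       ≡⟨ sym (ℚₚ.*-identityʳ c) ⟩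
    c * 1ℚ                  ≡⟨ cong (c *_) (sym (F-wordOf Φ)) ⟩
    c * F Φ n (wordOf Φ)    ≡⟨ sym (∑-single-key proj₁ keys-unique e∈ others) ⟩
    ∑ (term n (wordOf Φ)) L ≡⟨ sym (linCombF-∑ L n (wordOf Φ)) ⟩
    linCombF L n (wordOf Φ) ≡⟨ L≐0 n (wordOf Φ) ⟩
    0ℚ                      ∎
    where
    open ≡-Reasoning
    others : ∀ {e′} → e′ ∈ L → proj₁ e′ ≢ (n , Φ) → term n (wordOf Φ) e′ ≡ 0ℚ
    others {(n′ , Ψ) , c′} e′∈ e′≢e = case n ℕ.≟ n′ of λ where
      (no n≢n′) → trans (cong (c′ *_) (extend-≢ _ (wordOf Φ) n≢n′)) (ℚₚ.*-zeroʳ c′)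
      (yes refl) → case YCond? (GΦ Ψ) (wordOf Φ) of λ where
        (no ¬y) → trans (cong (c′ *_) (Y-no {G = GΦ Ψ} {wordOf Φ} ¬y)) (ℚₚ.*-zeroʳ c′)
        (yes y) → trans (cong (_* F Ψ n (wordOf Φ)) (go _ e′∈ (rec (≼-#before-< {Φ = Ψ} {Φ}
                    (YCond-G-wordOf⇒≼ Ψ Φ y) (e′≢e ∘ cong (n ,_))))))
                  (ℚₚ.*-zeroˡ (F Ψ n (wordOf Φ)))

mainTheorem17 : ((n : ℕ) (Φ : SetComp n) →
    ∃ λ (Ψs : List (SetComp n)) →
    Unique Ψs ×
    ((Ψ : SetComp n) → (Ψ ∈ Ψs) ⇔ Reforms Ψ Φ) ×
    ((m : ℕ) (w : Vec ℕ m) → F Φ m w ≡ sumS (map M Ψs) m w))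
    ×
    (((n : ℕ) (Φ : SetComp n) → InNCQSym (F Φ)) ×
    ((f : Series) → InNCQSym f →
    ∃ λ (L : List (AnySetComp × ℚ)) →
    (m : ℕ) (w : Vec ℕ m) → f m w ≡ linCombF L m w) ×
    ((L : List (AnySetComp × ℚ)) → Unique (map proj₁ L) →
    ((m : ℕ) (w : Vec ℕ m) → linCombF L m w ≡ 0ℚ) →
    All (λ p → proj₂ p ≡ 0ℚ) L))
mainTheorem17 =
  (λ n Φ → reformsOf Φ , reformsOf-unique Φ , ∈-reformsOf⇔Reforms Φ , F≐∑M Φ) ,
  (λ n → F∈NCQSym) ,
  NCQSym⊆span ,
  linCombF-independent
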